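{- Let $T$ be a tree with $n\ge1$ vertices and let $\ell\ge n$ be an integer. Then every near-minimally self-reachable configuration on $T$ with $\ell$ chips (about any vertex) is a vertex of the polytope $P_\ell(T)$.
   Context: Label the vertices $v_1,\dots,v_n$; $e_i$ is the $i$th standard basis vector. A chip configuration on $T$ is a vector $c\in\mathbb{Z}_{\ge0}^n$. The Laplacian $\Delta(T)$ has $\Delta_{ii}=\deg(v_i)$, $\Delta_{ij}=-1$ if $v_iv_j$ is an edge, $0$ otherwise; firing $v_i$ from $c$ produces $c-\Delta(T)e_i$, legal if $c_i\ge\deg(v_i)$. A configuration is self-reachable on $T$ if some nonempty finite sequence of legal firings starting from it returns to it. (Known: equivalently, it has at least $m-1$ chips on every $m$-vertex subtree.) It is minimally self-reachable if self-reachable with exactly $n-1$ chips. A configuration $\nu$ is near-minimally self-reachable if it is self-reachable and not minimally self-reachable, and there is a unique $i$ with $\nu-e_i$ self-reachable on $T$; it is then near-minimally self-reachable about $v_i$. $S_\ell^{(T)}$ is the set of self-reachable configurations with exactly $\ell$ chips and $P_\ell(T)=\mathrm{conv}(S_\ell^{(T)})$.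
   Formalization: The convex combinations in the notion of a vertex of $P_\ell(T)$ have their coefficients taken in ℚ. -}

module Defs where

open import Data.Nat using (ℕ; zero; suc; _+_; _∸_; _≤_; _≥_)
open import Data.Bool using (Bool; true; false; if_then_else_)
open import Data.Fin using (Fin; _≟_)
open import Data.List using (List; []; _∷_; map; allFin; length; foldr)
open import Data.List.Relation.Unary.Unique.Propositional using (Unique)
import Data.List.Relation.Unary.All
import Data.Nat.ListAction
open import Data.Product using (Σ; _×_; _,_; ∃; ∃-syntax)
open import Relation.Nullary using (¬_; does)
open import Relation.Binary.PropositionalEquality using (_≡_; _≢_)
open import Data.Integer using (+_)
import Data.Rational as ℚ
open ℚ using (ℚ; 0ℚ; 1ℚ)

record Graph (n : ℕ) : Set where
  field
    adj   : Fin n → Fin n → Bool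
    sym   : ∀ u v → adj u v ≡ adj v u
    irrefl : ∀ u → adj u u ≡ false
open Graph public

Σv : ∀ {n} → (Fin n → ℕ) → ℕ
Σv {n} f = Data.Nat.ListAction.sum (map f (allFin n))

deg : ∀ {n} → Graph n → Fin n → ℕ
deg G v = Σv (λ u → if adj G v u then 1 else 0)

data Walk {n} (G : Graph n) : Fin n → Fin n → Set where
  here : ∀ u → Walk G u u
  step : ∀ {u w v} → adj G u w ≡ true → Walk G w v → Walk G u v

Connected : ∀ {n} → Graph n → Set
Connected G = ∀ u v → Walk G u v

data PathFromTo {n} (G : Graph n) : Fin n → List (Fin n) → Fin n → Set where
  end  : ∀ {u} → PathFromTo G u [] u
  cons : ∀ {u w xs v} → adj G u w ≡ true → PathFromTo G w xs v →
         PathFromTo G u (w ∷ xs) v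

-- A cycle: distinct vertices v0, v1, ..., vk (k ≥ 2, i.e. at least 3
-- vertices), consecutive ones adjacent, and vk adjacent to v0.
record Cycle {n} (G : Graph n) : Set where
  field
    v₀    : Fin n
    rest  : List (Fin n)
    last  : Fin n
    long  : 2 ≤ length rest
    dist  : Unique (v₀ ∷ rest)
    path  : PathFromTo G v₀ rest last
    close : adj G last v₀ ≡ true

Acyclic : ∀ {n} → Graph n → Set
Acyclic G = ¬ Cycle G

IsTree : ∀ {n} → Graph n → Set
IsTree G = Connected G × Acyclic G

Config : ℕ → Set
Config n = Fin n → ℕ

chips : ∀ {n} → Config n → ℕ
chips c = Σv c

-- c - Δ(G) e_v   (only used when the firing is legal, c v ≥ deg v)
fire : ∀ {n} → Graph n → Config n → Fin n → Config n
fire G c v u =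
  if does (u ≟ v) then c u ∸ deg G v
  else (if adj G v u then suc (c u) else c u)

_≗c_ : ∀ {n} → Config n → Config n → Set
c ≗c d = ∀ u → c u ≡ d u

data LegalSeq {n} (G : Graph n) : Config n → List (Fin n) → Config n → Set where
  done : ∀ {c d} → c ≗c d → LegalSeq G c [] d
  fire∷ : ∀ {c v vs d} → c v ≥ deg G v →
          LegalSeq G (fire G c v) vs d → LegalSeq G c (v ∷ vs) d

SelfReachable : ∀ {n} → Graph n → Config n → Set
SelfReachable G c = ∃[ vs ] (vs ≢ [] × LegalSeq G c vs c)

MinSelfReachable : ∀ {n} → Graph n → Config n → Set
MinSelfReachable {n} G c = SelfReachable G c × chips c ≡ n ∸ 1

-- c - e_i (only meaningful as a configuration when c i ≥ 1)
minusE : ∀ {n} → Config n → Fin n → Config n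
minusE c i u = if does (u ≟ i) then c u ∸ 1 else c u

-- c - e_i is a (nonnegative) configuration that is self-reachable
MinusSR : ∀ {n} → Graph n → Config n → Fin n → Set
MinusSR G c i = 1 ≤ c i × SelfReachable G (minusE c i)

NearMinSRAbout : ∀ {n} → Graph n → Config n → Fin n → Set
NearMinSRAbout G ν i =
  SelfReachable G ν × ¬ MinSelfReachable G ν ×
  MinusSR G ν i × (∀ j → MinusSR G ν j → j ≡ i)

NearMinSR : ∀ {n} → Graph n → Config n → Set
NearMinSR G ν = ∃[ i ] NearMinSRAbout G ν i

InS : ∀ {n} → Graph n → ℕ → Config n → Set
InS G ℓ c = SelfReachable G c × chips c ≡ ℓ

toℚ : ℕ → ℚ
toℚ k = (+ k) ℚ./ 1


sumℚ : List ℚ → ℚ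
sumℚ = foldr ℚ._+_ 0ℚ

record ConvComb {n} (P : Config n → Set) (x : Config n) : Set where
  field
    pts     : List (ℚ × Config n)
    nonneg  : Data.List.Relation.Unary.All.All (λ p → 0ℚ ℚ.≤ Data.Product.proj₁ p) pts
    inP     : Data.List.Relation.Unary.All.All (λ p → P (Data.Product.proj₂ p)) pts
    total   : sumℚ (map Data.Product.proj₁ pts) ≡ 1ℚ
    combo   : ∀ u → sumℚ (map (λ p → Data.Product.proj₁ p ℚ.* toℚ (Data.Product.proj₂ p u)) pts)
                      ≡ toℚ (x u)

-- ν is a vertex of P_ℓ(T) = conv(S_ℓ): it lies in S_ℓ and is not a
-- convex combination of points of S_ℓ different from ν.
IsVertexOfP : ∀ {n} → Graph n → ℕ → Config n → Set
IsVertexOfP G ℓ ν =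
  InS G ℓ ν × ¬ ConvComb (λ c → InS G ℓ c × ¬ (c ≗c ν)) ν

{-# OPTIONS --safe #-}
-- A configuration c on a connected graph is self-reachable iff there is a ranking r of the
-- vertices (an injective map into ℕ) such that every vertex u has at most c u neighbours of
-- higher rank: fire every vertex once in increasing order of rank; conversely, rank the vertices
-- of a legal firing sequence returning to c by the time of their last firing.
--
-- Let ν be near-minimal about i and r such a ranking for ν. For u ≠ i the bound is attained at
-- u, for otherwise ν − e_u would be self-reachable as well. Every ranking has the same total
-- out-degree (the number of edges), so the ranking of ν − e_i shows that the bound is slack at i.
-- Moving i to just below its highest-ranked lower neighbour u would make ν − e_u self-reachable,
-- so every neighbour of i has higher rank. Now weight i by 0 and every other vertex y by 1 + r y:
-- every edge is oriented by r towards its heavier endpoint, so r minimises the weighted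
-- out-degree over all rankings, and every minimiser has the same out-degrees as r. Hence every
-- other self-reachable configuration with as many chips as ν has strictly larger weight than ν,
-- and this linear functional separates ν from the rest of S_ℓ.
module Submission where

open import Defs renaming (sym to adj-sym; irrefl to adj-irrefl)

open import Algebra.Bundles using (CommutativeRing)
import Algebra.Properties.CommutativeSemigroup as CommutativeSemigroupProperties
import Algebra.Properties.Semiring.Sum as SemiringSum
open import Data.Bool using (Bool; true; false; T; if_then_else_; _∨_)
open import Data.Bool.Properties using (T-∨)
open import Data.Fin using (Fin; zero; suc; _≟_; fromℕ<)
open import Data.Fin.Properties using (punchInᵢ≢i; any?)
import Data.Integer as ℤ
import Data.Integer.Properties as ℤ
open import Data.List using (List; []; _∷_; map; tabulate; allFin; filter)
open import Data.List.Extrema.Nat using (argmin; argmax; argmin-all; argmax-all; f[argmin]≤f[xs]; f[xs]≤f[argmax])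
open import Data.List.Membership.Propositional.Properties using (∈-filter⁺; ∈-allFin)
open import Data.List.Properties using (map-tabulate; map-cong)
open import Data.List.Relation.Unary.All using (All; []; _∷_; lookup)
open import Data.List.Relation.Unary.All.Properties using (all-filter)
open import Data.Nat using (ℕ; zero; suc; _+_; _*_; _∸_; _≤_; _<_; z≤n; s≤s; _<?_; _≤?_)
open import Data.Nat.Coprimality using (1-coprimeTo)
import Data.Nat.Coprimality as Coprime
import Data.Nat.ListAction as ListAction
open import Data.Nat.Properties hiding (_≟_)
open import Data.Product using (_×_; _,_; proj₁; proj₂; map₁; map₂; ∃; ∃-syntax)
open import Data.Rational using (ℚ; 0ℚ; 1ℚ; mkℚ)
import Data.Rational as ℚ
import Data.Rational.Properties as ℚ
open import Data.Sum using (_⊎_; inj₁; inj₂; [_,_]; [_,_]′)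
open import Data.Unit using (tt)
open import Data.Vec.Functional using (removeAt)
open import Function using (_∘_; id; _$_)
open import Function.Bundles using (Equivalence; _⇔_; mk⇔)
open import Function.Definitions using (Injective)
open import Level using (Level)
open import Relation.Binary.PropositionalEquality hiding ([_])
open import Relation.Nullary using (¬_; Dec; yes; no; does; contradiction)
open import Relation.Nullary.Decidable using (_×-dec_; ¬?; T?; dec-true; dec-false; toSum; decidable-stable)
open import Relation.Unary using (Pred; Decidable)
open import Relation.Unary.Properties using (_∩?_)

open SemiringSum +-*-semiring
  using (sum; sum-syntax; sum-cong-≗; sum-remove; sum-replicate-zero; ∑-distrib-+; ∑-comm; *-distribˡ-sum)
open CommutativeSemigroupProperties +-commutativeSemigroup using () renaming (xy∙z≈xz∙y to +-right-comm)

private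
  variable
    a b : Level
    A : Set a
    B : Set b

≢⇒<⊎> : ∀ {m n} → m ≢ n → m < n ⊎ n < m
≢⇒<⊎> {m} {n} m≢n =
  [ (λ m≤n → inj₁ (≤∧≢⇒< m≤n m≢n)) , (λ n≤m → inj₂ (≤∧≢⇒< n≤m (m≢n ∘ sym))) ]′ (≤-total m n)

<⇒≤∸1 : ∀ {m n} → m < n → m ≤ n ∸ 1
<⇒≤∸1 (s≤s m≤n) = m≤n

≤∸1⇒< : ∀ {m n} → 0 < n → m ≤ n ∸ 1 → m < n
≤∸1⇒< {n = suc n} _ m≤n = s≤s m≤n

Σv≡sum : ∀ {n} (f : Fin n → ℕ) → Σv f ≡ sum f
Σv≡sum {zero}  f = refl
Σv≡sum {suc n} f = cong (f zero +_) (begin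
  ListAction.sum (map f (tabulate suc))  ≡⟨ cong ListAction.sum (map-tabulate suc f) ⟩
  ListAction.sum (tabulate (f ∘ suc))    ≡⟨ cong ListAction.sum (map-tabulate id (f ∘ suc)) ⟨
  Σv (f ∘ suc)                           ≡⟨ Σv≡sum (f ∘ suc) ⟩
  sum (f ∘ suc)                          ∎)
  where open ≡-Reasoning

∑-mono-≤ : ∀ {n} {f g : Fin n → ℕ} → (∀ x → f x ≤ g x) → sum f ≤ sum g
∑-mono-≤ {zero}  f≤g = z≤n
∑-mono-≤ {suc n} f≤g = +-mono-≤ (f≤g zero) (∑-mono-≤ (f≤g ∘ suc))

∑-≤-antisym : ∀ {n} {f g : Fin n → ℕ} → (∀ x → f x ≤ g x) → sum g ≤ sum f → ∀ x → f x ≡ g x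
∑-≤-antisym {suc n} {f} {g} f≤g ∑g≤∑f zero = ≤-antisym (f≤g zero)
  (+-cancelʳ-≤ _ _ _ (≤-trans ∑g≤∑f (+-monoʳ-≤ (f zero) (∑-mono-≤ (f≤g ∘ suc)))))
∑-≤-antisym {suc n} {f} {g} f≤g ∑g≤∑f (suc x) = ∑-≤-antisym (f≤g ∘ suc)
  (+-cancelˡ-≤ (f zero) _ _ (≤-trans (+-monoˡ-≤ _ (f≤g zero)) ∑g≤∑f)) x

≤-∑ : ∀ {n} (f : Fin n → ℕ) i → f i ≤ sum f
≤-∑ {suc n} f i = ≤-trans (m≤m+n (f i) _) (≤-reflexive (sym (sum-remove f)))

∑-≤-except : ∀ {n} {f g : Fin n → ℕ} i → (∀ x → x ≢ i → f x ≤ g x) →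
             sum f + g i ≤ sum g + f i
∑-≤-except {suc n} {f} {g} i f≤g = begin
  sum f + g i                       ≡⟨ cong (_+ g i) (sum-remove f) ⟩
  f i + sum (removeAt f i) + g i    ≤⟨ +-monoˡ-≤ (g i) (+-monoʳ-≤ (f i) (∑-mono-≤ λ x → f≤g _ (punchInᵢ≢i i x))) ⟩
  f i + sum (removeAt g i) + g i    ≡⟨ +-comm (f i + _) (g i) ⟩
  g i + (f i + sum (removeAt g i))  ≡⟨ cong (g i +_) (+-comm (f i) _) ⟩
  g i + (sum (removeAt g i) + f i)  ≡⟨ +-assoc (g i) _ (f i) ⟨
  g i + sum (removeAt g i) + f i    ≡⟨ cong (_+ f i) (sum-remove g) ⟨
  sum g + f i                       ∎
  where open ≤-Reasoning

∑-≡-except : ∀ {n} {f g : Fin n → ℕ} i → (∀ x → x ≢ i → f x ≡ g x) →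
             sum f + g i ≡ sum g + f i
∑-≡-except i f≡g = ≤-antisym (∑-≤-except i (λ x x≢i → ≤-reflexive (f≡g x x≢i)))
                             (∑-≤-except i (λ x x≢i → ≤-reflexive (sym (f≡g x x≢i))))

indicator : ∀ {a} {A : Set a} → Dec A → ℕ
indicator a? = if does a? then 1 else 0

indicator-yes : (a? : Dec A) → A → indicator a? ≡ 1
indicator-yes (yes _) _ = refl
indicator-yes (no ¬a) a = contradiction a ¬a

indicator-no : (a? : Dec A) → ¬ A → indicator a? ≡ 0
indicator-no (yes a) ¬a = contradiction a ¬a
indicator-no (no _)  _  = refl

indicator-pos : (a? : Dec A) → 0 < indicator a? → A
indicator-pos (yes a) _ = a

indicator-mono : (a? : Dec A) (b? : Dec B) → (A → B) → indicator a? ≤ indicator b?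
indicator-mono (no _)  _       _   = z≤n
indicator-mono (yes _) (yes _) _   = ≤-refl
indicator-mono (yes a) (no ¬b) a→b = contradiction (a→b a) ¬b

indicator-⊎ : ∀ {c} {C : Set c} (a? : Dec A) (b? : Dec B) (c? : Dec C) →
              (C → A ⊎ B) → (A → C) → (B → C) → (A → ¬ B) →
              indicator a? + indicator b? ≡ indicator c?
indicator-⊎ (yes a) (yes b) _       _   _   _   a→¬b = contradiction b (a→¬b a)
indicator-⊎ (yes a) (no _)  c?      _   a→c _   _    = sym (indicator-yes c? (a→c a))
indicator-⊎ (no _)  (yes b) c?      _   _   b→c _    = sym (indicator-yes c? (b→c b))
indicator-⊎ (no ¬a) (no ¬b) c?      c→⊎ _   _   _    =
  sym (indicator-no c? λ c → [ ¬a , ¬b ] (c→⊎ c))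

indicator-cong : (a? : Dec A) (b? : Dec B) → (A → B) → (B → A) → indicator a? ≡ indicator b?
indicator-cong a? b? a→b b→a = ≤-antisym (indicator-mono a? b? a→b) (indicator-mono b? a? b→a)

opaque
  count : ∀ {n ℓ} {P : Pred (Fin n) ℓ} → Decidable P → ℕ
  count {n} P? = ∑[ x < n ] indicator (P? x)

module _ {n ℓ} {P : Pred (Fin n) ℓ} {P? : Decidable P} where
  opaque
    unfolding count

    count-none : (∀ x → ¬ P x) → count P? ≡ 0
    count-none none = trans (sum-cong-≗ λ x → indicator-no (P? x) (none x)) (sum-replicate-zero n)

    count-pos : ∀ {x} → P x → 0 < count P?
    count-pos {x} px = ≤-trans (≤-reflexive (sym (indicator-yes (P? x) px))) (≤-∑ (indicator ∘ P?) x)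

    *-count : ∀ k → k * count P? ≡ ∑[ x < n ] (k * indicator (P? x))
    *-count k = *-distribˡ-sum k (indicator ∘ P?)

    Σv-indicator : Σv (indicator ∘ P?) ≡ count P?
    Σv-indicator = Σv≡sum (indicator ∘ P?)

module _ {n ℓ₁ ℓ₂} {P : Pred (Fin n) ℓ₁} {Q : Pred (Fin n) ℓ₂} {P? : Decidable P} {Q? : Decidable Q} where
  opaque
    unfolding count

    count-mono : (∀ {x} → P x → Q x) → count P? ≤ count Q?
    count-mono P⊆Q = ∑-mono-≤ λ x → indicator-mono (P? x) (Q? x) P⊆Q

    count-cong : (∀ {x} → P x → Q x) → (∀ {x} → Q x → P x) → count P? ≡ count Q?
    count-cong P⊆Q Q⊆P = sum-cong-≗ λ x → indicator-cong (P? x) (Q? x) P⊆Q Q⊆P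

    count-≤-except : ∀ v → (∀ {x} → x ≢ v → P x → Q x) →
                     count P? + indicator (Q? v) ≤ count Q? + indicator (P? v)
    count-≤-except v P⊆Q = ∑-≤-except v λ x x≢v → indicator-mono (P? x) (Q? x) (P⊆Q x≢v)

    count-≡-except : ∀ v → (∀ {x} → x ≢ v → P x → Q x) → (∀ {x} → x ≢ v → Q x → P x) →
                     count P? + indicator (Q? v) ≡ count Q? + indicator (P? v)
    count-≡-except v P⊆Q Q⊆P = ∑-≡-except v λ x x≢v → indicator-cong (P? x) (Q? x) (P⊆Q x≢v) (Q⊆P x≢v)

    count-partition : ∀ {ℓ₃} {R : Pred (Fin n) ℓ₃} {R? : Decidable R} →
                      (∀ {x} → R x → P x ⊎ Q x) → (∀ {x} → P x → R x) → (∀ {x} → Q x → R x) →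
                      (∀ {x} → P x → ¬ Q x) → count P? + count Q? ≡ count R?
    count-partition {R? = R?} R⊆P∪Q P⊆R Q⊆R P∩Q=∅ = trans
      (sym (∑-distrib-+ (indicator ∘ P?) (indicator ∘ Q?)))
      (sum-cong-≗ λ x → indicator-⊎ (P? x) (Q? x) (R? x) R⊆P∪Q P⊆R Q⊆R P∩Q=∅)

opaque
  unfolding count

  count-transpose : ∀ {n ℓ} {E : Fin n → Fin n → Set ℓ} (E? : ∀ u → Decidable (E u)) →
                    sum (λ u → count (E? u)) ≡ sum (λ x → count (λ u → E? u x))
  count-transpose E? = ∑-comm (λ u x → indicator (E? u x))

module _ {n p} {P : Pred (Fin n) p} (P? : Decidable P) (f : Fin n → ℕ) where

  least : ∃ P → ∃[ v ] P v × (∀ {x} → P x → f v ≤ f x)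
  least (v₀ , pv₀) = argmin f v₀ xs , argmin-all f pv₀ (all-filter P? (allFin n)) ,
                     λ {x} px → lookup (f[argmin]≤f[xs] v₀ xs) (∈-filter⁺ P? (∈-allFin x) px)
    where xs = filter P? (allFin n)

  greatest : ∃ P → ∃[ v ] P v × (∀ {x} → P x → f x ≤ f v)
  greatest (v₀ , pv₀) = argmax f v₀ xs , argmax-all f pv₀ (all-filter P? (allFin n)) ,
                        λ {x} px → lookup (f[xs]≤f[argmax] v₀ xs) (∈-filter⁺ P? (∈-allFin x) px)
    where xs = filter P? (allFin n)

module _ {n} (G : Graph n) where

  Adjacent : Fin n → Fin n → Set
  Adjacent u x = T (adj G u x)

  adjacent? : ∀ u → Decidable (Adjacent u)
  adjacent? u x = T? (adj G u x)

  Adjacent-sym : ∀ {u x} → Adjacent u x → Adjacent x u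
  Adjacent-sym {u} {x} = subst T (adj-sym G u x)

  Adjacent⇒≢ : ∀ {u x} → Adjacent u x → u ≢ x
  Adjacent⇒≢ {u} a refl = subst T (adj-irrefl G u) a

  deg≡count : ∀ u → deg G u ≡ count (adjacent? u)
  deg≡count u = Σv-indicator

  fire-self : ∀ c v → fire G c v v ≡ c v ∸ deg G v
  fire-self c v rewrite dec-true (v ≟ v) refl = refl

  fire-other : ∀ c v {u} → u ≢ v → fire G c v u ≡ c u + indicator (adjacent? v u)
  fire-other c v {u} u≢v rewrite dec-false (u ≟ v) u≢v with adj G v u
  ... | true  = +-comm 1 (c u)
  ... | false = sym (+-identityʳ (c u))

  outdeg : (Fin n → ℕ) → Fin n → ℕ
  outdeg r u = count (adjacent? u ∩? λ x → r u <? r x)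

  indeg : (Fin n → ℕ) → Fin n → ℕ
  indeg r u = count (adjacent? u ∩? λ x → r x <? r u)

  outdeg+indeg≡deg : ∀ {r} → Injective _≡_ _≡_ r → ∀ u → outdeg r u + indeg r u ≡ deg G u
  outdeg+indeg≡deg {r} r-inj u = trans (count-partition up-or-down proj₁ proj₁ λ (_ , u<x) (_ , x<u) → <-asym u<x x<u)
                                   (sym (deg≡count u))
    where
    up-or-down : ∀ {x} → Adjacent u x → Adjacent u x × r u < r x ⊎ Adjacent u x × r x < r u
    up-or-down u~x = Data.Sum.map (u~x ,_) (u~x ,_) (≢⇒<⊎> (Adjacent⇒≢ u~x ∘ r-inj))

  ∑indeg≡∑outdeg : ∀ r → sum (indeg r) ≡ sum (outdeg r)
  ∑indeg≡∑outdeg r = trans (count-transpose λ u → adjacent? u ∩? λ x → r x <? r u) (sum-cong-≗ transposed)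
    where
    transposed : ∀ x → count (λ u → (adjacent? u ∩? λ y → r y <? r u) x) ≡ outdeg r x
    transposed x = count-cong (map₁ Adjacent-sym) (map₁ Adjacent-sym)

  handshake : ∀ {r} → Injective _≡_ _≡_ r → 2 * sum (outdeg r) ≡ sum (deg G)
  handshake {r} r-inj = begin
    2 * sum (outdeg r)                  ≡⟨ cong (sum (outdeg r) +_) (+-identityʳ _) ⟩
    sum (outdeg r) + sum (outdeg r)     ≡⟨ cong (sum (outdeg r) +_) (∑indeg≡∑outdeg r) ⟨
    sum (outdeg r) + sum (indeg r)      ≡⟨ ∑-distrib-+ (outdeg r) (indeg r) ⟨
    ∑[ u < n ] (outdeg r u + indeg r u) ≡⟨ sum-cong-≗ (outdeg+indeg≡deg r-inj) ⟩
    sum (deg G)                         ∎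
    where open ≡-Reasoning

  ∑outdeg-invariant : ∀ {r s} → Injective _≡_ _≡_ r → Injective _≡_ _≡_ s →
                      sum (outdeg r) ≡ sum (outdeg s)
  ∑outdeg-invariant r-inj s-inj = *-cancelˡ-≡ _ _ 2 (trans (handshake r-inj) (sym (handshake s-inj)))

-- Orienting every edge towards its endpoint of higher rank gives an acyclic
-- orientation, and every acyclic orientation arises in this way.
record AcyclicOrientationBelow {n} (G : Graph n) (c : Config n) : Set where
  field
    rank           : Fin n → ℕ
    rank-injective : Injective _≡_ _≡_ rank
    outdeg≤        : ∀ u → outdeg G rank u ≤ c u

-- Firing every vertex once, in increasing order of rank

add : ∀ {n} → Fin n → (Fin n → Bool) → Fin n → Bool
add v F x = does (x ≟ v) ∨ F x

add-self : ∀ {n} (v : Fin n) F → T (add v F v)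
add-self v F rewrite dec-true (v ≟ v) refl = tt

add-other : ∀ {n} {v x : Fin n} F → x ≢ v → add v F x ≡ F x
add-other {v = v} {x} F x≢v rewrite dec-false (x ≟ v) x≢v = refl

firedNeighbours : ∀ {n} → Graph n → (Fin n → Bool) → Fin n → ℕ
firedNeighbours G F u = count (adjacent? G u ∩? T? ∘ F)

module _ {n} (G : Graph n) (c : Config n) where

  -- d = c − Δ(G)·1_F, i.e. firing each vertex of F once leads from c to d (stated without subtraction)
  FiredOnce : (Fin n → Bool) → Config n → Set
  FiredOnce F d = ∀ u → d u + indicator (T? (F u)) * deg G u ≡ c u + firedNeighbours G F u

  FiredOnce-none : FiredOnce (λ _ → false) c
  FiredOnce-none u = cong (c u +_) (sym (count-none λ _ → proj₂))

  FiredOnce-all : ∀ {F d} → (∀ x → T (F x)) → FiredOnce F d → d ≗c c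
  FiredOnce-all {F} {d} all inv u = +-cancelʳ-≡ _ (d u) (c u) (begin
    d u + deg G u                         ≡⟨ cong (d u +_) (*-identityˡ (deg G u)) ⟨
    d u + 1 * deg G u                     ≡⟨ cong (λ k → d u + k * deg G u) (indicator-yes (T? (F u)) (all u)) ⟨
    d u + indicator (T? (F u)) * deg G u  ≡⟨ inv u ⟩
    c u + firedNeighbours G F u           ≡⟨ cong (c u +_) (count-cong proj₁ λ {x} u~x → u~x , all x) ⟩
    c u + count (adjacent? G u)           ≡⟨ cong (c u +_) (deg≡count G u) ⟨
    c u + deg G u                         ∎)
    where open ≡-Reasoning

  module _ {F d v} (inv : FiredOnce F d) (v∉F : ¬ T (F v)) where

    FiredOnce-fire-self : deg G v ≤ d v →
      fire G d v v + indicator (T? (add v F v)) * deg G v ≡ c v + firedNeighbours G (add v F) v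
    FiredOnce-fire-self legal = begin
      fire G d v v + indicator (T? (add v F v)) * deg G v  ≡⟨ cong₂ (λ a k → a + k * deg G v) (fire-self G d v)
                                                                (indicator-yes (T? (add v F v)) (add-self v F)) ⟩
      d v ∸ deg G v + 1 * deg G v                          ≡⟨ cong (d v ∸ deg G v +_) (*-identityˡ (deg G v)) ⟩
      d v ∸ deg G v + deg G v                              ≡⟨ m∸n+n≡m legal ⟩
      d v                                                  ≡⟨ +-identityʳ (d v) ⟨
      d v + 0 * deg G v                                    ≡⟨ cong (λ k → d v + k * deg G v) (indicator-no (T? (F v)) v∉F) ⟨
      d v + indicator (T? (F v)) * deg G v                 ≡⟨ inv v ⟩
      c v + firedNeighbours G F v                          ≡⟨ cong (c v +_) (count-cong (map₂ ⊆add) (λ (v~x , x∈F′) → v~x , ⊆F v~x x∈F′)) ⟩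
      c v + firedNeighbours G (add v F) v                  ∎
      where
      open ≡-Reasoning
      ⊆add : ∀ {x} → T (F x) → T (add v F x)
      ⊆add x∈F = Equivalence.from T-∨ (inj₂ x∈F)
      ⊆F : ∀ {x} → Adjacent G v x → T (add v F x) → T (F x)
      ⊆F v~x = subst T (add-other F (Adjacent⇒≢ G v~x ∘ sym))

    FiredOnce-fire-other : ∀ {u} → u ≢ v →
      fire G d v u + indicator (T? (add v F u)) * deg G u ≡ c u + firedNeighbours G (add v F) u
    FiredOnce-fire-other {u} u≢v = begin
      fire G d v u + indicator (T? (add v F u)) * deg G u                ≡⟨ cong₂ (λ a b → a + indicator (T? b) * deg G u)
                                                                              (fire-other G d v u≢v) (add-other F u≢v) ⟩
      d u + indicator (adjacent? G v u) + indicator (T? (F u)) * deg G u ≡⟨ +-right-comm (d u) _ _ ⟩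
      d u + indicator (T? (F u)) * deg G u + indicator (adjacent? G v u) ≡⟨ cong (_+ indicator (adjacent? G v u)) (inv u) ⟩
      c u + firedNeighbours G F u + indicator (adjacent? G v u)          ≡⟨ +-assoc (c u) _ _ ⟩
      c u + (firedNeighbours G F u + indicator (adjacent? G v u))        ≡⟨ cong (c u +_) v-newly-fired ⟩
      c u + firedNeighbours G (add v F) u                                ∎
      where
      open ≡-Reasoning
      after? = adjacent? G u ∩? T? ∘ add v F
      before? = adjacent? G u ∩? T? ∘ F
      v-newly-fired : firedNeighbours G F u + indicator (adjacent? G v u) ≡ firedNeighbours G (add v F) u
      v-newly-fired = begin
        count before? + indicator (adjacent? G v u)  ≡⟨ cong (count before? +_) (indicator-cong (adjacent? G v u) (after? v)
                                                          (λ v~u → Adjacent-sym G v~u , add-self v F) (Adjacent-sym G ∘ proj₁)) ⟩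
        count before? + indicator (after? v)         ≡⟨ count-≡-except v (λ x≢v → map₂ (subst T (add-other F x≢v)))
                                                                         (λ x≢v → map₂ (subst T (sym (add-other F x≢v)))) ⟨
        count after? + indicator (before? v)         ≡⟨ cong (count after? +_) (indicator-no (before? v) (v∉F ∘ proj₂)) ⟩
        count after? + 0                             ≡⟨ +-identityʳ _ ⟩
        count after?                                 ∎

    FiredOnce-fire : deg G v ≤ d v → FiredOnce (add v F) (fire G d v)
    FiredOnce-fire legal u = [ (λ { refl → FiredOnce-fire-self legal }) , FiredOnce-fire-other ]′ (toSum (u ≟ v))

unfired? : ∀ {n} (F : Fin n → Bool) → Decidable (λ x → ¬ T (F x))
unfired? F x = ¬? (T? (F x))

count-unfired-add : ∀ {n} {F : Fin n → Bool} {v} → ¬ T (F v) →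
                    suc (count (unfired? (add v F))) ≡ count (unfired? F)
count-unfired-add {F = F} {v} v∉F = begin
  suc (count after?)                   ≡⟨ +-comm 1 _ ⟩
  count after? + 1                     ≡⟨ cong (count after? +_) (indicator-yes (before? v) v∉F) ⟨
  count after? + indicator (before? v) ≡⟨ count-≡-except v (λ x≢v → _∘ subst T (sym (add-other F x≢v)))
                                                           (λ x≢v → _∘ subst T (add-other F x≢v)) ⟩
  count before? + indicator (after? v) ≡⟨ cong (count before? +_) (indicator-no (after? v) (_$ add-self v F)) ⟩
  count before? + 0                    ≡⟨ +-identityʳ _ ⟩
  count before?                        ∎
  where
  open ≡-Reasoning
  after? = unfired? (add v F)
  before? = unfired? F

module _ {n} {G : Graph n} {c : Config n} (o : AcyclicOrientationBelow G c) where
  open AcyclicOrientationBelow o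

  least-unfired-legal : ∀ {F d v} → FiredOnce G c F d → ¬ T (F v) →
                        (∀ {x} → ¬ T (F x) → rank v ≤ rank x) → deg G v ≤ d v
  least-unfired-legal {F} {d} {v} inv v∉F v-least = begin
    deg G v                                 ≡⟨ outdeg+indeg≡deg G rank-injective v ⟨
    outdeg G rank v + indeg G rank v        ≤⟨ +-mono-≤ (outdeg≤ v) (count-mono lower-fired) ⟩
    c v + firedNeighbours G F v             ≡⟨ inv v ⟨
    d v + indicator (T? (F v)) * deg G v    ≡⟨ cong (λ k → d v + k * deg G v) (indicator-no (T? (F v)) v∉F) ⟩
    d v + 0                                 ≡⟨ +-identityʳ (d v) ⟩
    d v                                     ∎
    where
    open ≤-Reasoning
    lower-fired : ∀ {x} → Adjacent G v x × rank x < rank v → Adjacent G v x × T (F x)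
    lower-fired {x} (v~x , x<v) = v~x , decidable-stable (T? (F x)) (λ x∉F → <⇒≱ x<v (v-least x∉F))

  fire-unfired : ∀ k F d → count (unfired? F) ≤ k → FiredOnce G c F d →
                 ∃[ vs ] LegalSeq G d vs c × (∀ {x} → ¬ T (F x) → vs ≢ [])
  fire-unfired k F d size inv with any? (unfired? F)
  ... | no none = [] , done (FiredOnce-all G c all-fired inv) , λ x∉F → contradiction (_ , x∉F) none
    where
    all-fired : ∀ x → T (F x)
    all-fired x = decidable-stable (T? (F x)) (λ x∉F → none (x , x∉F))
  fire-unfired zero    F d size inv | yes (x , x∉F) = contradiction (≤-trans (count-pos x∉F) size) λ ()
  fire-unfired (suc k) F d size inv | yes some with least (unfired? F) rank some
  ... | v , v∉F , v-least with fire-unfired k (add v F) (fire G d v)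
                                 (≤-pred (≤-trans (≤-reflexive (count-unfired-add v∉F)) size))
                                 (FiredOnce-fire G c inv v∉F (least-unfired-legal inv v∉F v-least))
  ...   | vs , seq , _ = v ∷ vs , fire∷ (least-unfired-legal inv v∉F v-least) seq , λ _ ()

AcyclicOrientationBelow⇒SelfReachable : ∀ {n} {G : Graph n} {c} → 1 ≤ n →
                                         AcyclicOrientationBelow G c → SelfReachable G c
AcyclicOrientationBelow⇒SelfReachable {G = G} {c} 1≤n o
  with fire-unfired o _ (λ _ → false) c ≤-refl (FiredOnce-none G c)
... | vs , seq , nonempty = vs , nonempty {fromℕ< 1≤n} id , seq

-- Ranking the vertices of a legal firing sequence by their last firing

-- 1 + the index of the last occurrence of u in vs, and 0 if u does not occur
lastFiring : ∀ {n} → List (Fin n) → Fin n → ℕ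
lastFiring []       u = 0
lastFiring (v ∷ vs) u with lastFiring vs u
... | suc k = suc (suc k)
... | zero  = indicator (u ≟ v)

module _ {n} (v : Fin n) (vs : List (Fin n)) where

  lastFiring-∷-fired : ∀ {x} → 0 < lastFiring vs x → lastFiring (v ∷ vs) x ≡ suc (lastFiring vs x)
  lastFiring-∷-fired {x} 0<t with lastFiring vs x
  ... | suc k = refl

  lastFiring-∷-unfired : ∀ {x} → lastFiring vs x ≡ 0 → lastFiring (v ∷ vs) x ≡ indicator (x ≟ v)
  lastFiring-∷-unfired {x} t≡0 with lastFiring vs x
  ... | zero = refl

  lastFiring-∷-≤1 : ∀ {x} → lastFiring vs x ≡ 0 → lastFiring (v ∷ vs) x ≤ 1
  lastFiring-∷-≤1 {x} t≡0 rewrite lastFiring-∷-unfired t≡0 = indicator-mono (x ≟ v) (yes tt) _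

  lastFiring-∷-head : 0 < lastFiring (v ∷ vs) v
  lastFiring-∷-head with lastFiring vs v
  ... | suc k = s≤s z≤n
  ... | zero  rewrite dec-true (v ≟ v) refl = s≤s z≤n

  lastFiring-∷-unfired⁻ : ∀ {x} → lastFiring (v ∷ vs) x ≡ 0 → lastFiring vs x ≡ 0 × x ≢ v
  lastFiring-∷-unfired⁻ {x} t′≡0 with m≤n⇒m<n∨m≡n (z≤n {lastFiring vs x})
  ... | inj₁ 0<tx = contradiction (trans (sym (lastFiring-∷-fired 0<tx)) t′≡0) λ ()
  ... | inj₂ 0≡tx = sym 0≡tx , λ x≡v →
    contradiction (trans (sym (indicator-yes (x ≟ v) x≡v)) (trans (sym (lastFiring-∷-unfired (sym 0≡tx))) t′≡0))
                  λ ()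

  lastFiring-∷-fired⁻ : ∀ {x} → x ≢ v → 0 < lastFiring (v ∷ vs) x → 0 < lastFiring vs x
  lastFiring-∷-fired⁻ {x} x≢v 0<t′x with m≤n⇒m<n∨m≡n (z≤n {lastFiring vs x})
  ... | inj₁ 0<tx = 0<tx
  ... | inj₂ 0≡tx = contradiction (indicator-pos (x ≟ v) (subst (0 <_) (lastFiring-∷-unfired (sym 0≡tx)) 0<t′x)) x≢v

  lastFiring-∷-1< : ∀ {x} → 1 < lastFiring (v ∷ vs) x → 0 < lastFiring vs x
  lastFiring-∷-1< {x} 1<t′x with m≤n⇒m<n∨m≡n (z≤n {lastFiring vs x})
  ... | inj₁ 0<tx = 0<tx
  ... | inj₂ 0≡tx = contradiction (lastFiring-∷-≤1 (sym 0≡tx)) (<⇒≱ 1<t′x)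

  lastFiring-∷-<-fired : ∀ {u x} → 0 < lastFiring vs u →
    lastFiring (v ∷ vs) u < lastFiring (v ∷ vs) x ⇔ lastFiring vs u < lastFiring vs x
  lastFiring-∷-<-fired {u} {x} 0<tu = mk⇔ to from
    where
    from : lastFiring vs u < lastFiring vs x → lastFiring (v ∷ vs) u < lastFiring (v ∷ vs) x
    from tu<tx rewrite lastFiring-∷-fired 0<tu | lastFiring-∷-fired (≤-trans (s≤s z≤n) tu<tx) = s≤s tu<tx
    to : lastFiring (v ∷ vs) u < lastFiring (v ∷ vs) x → lastFiring vs u < lastFiring vs x
    to t′u<t′x rewrite lastFiring-∷-fired 0<tu with m≤n⇒m<n∨m≡n (z≤n {lastFiring vs x})
    ... | inj₁ 0<tx rewrite lastFiring-∷-fired 0<tx = ≤-pred t′u<t′x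
    ... | inj₂ 0≡tx = contradiction (≤-trans t′u<t′x (lastFiring-∷-≤1 (sym 0≡tx))) λ { (s≤s ()) }

lastFiring-injective : ∀ {n} (vs : List (Fin n)) {u x} → 0 < lastFiring vs u →
                       lastFiring vs u ≡ lastFiring vs x → u ≡ x
lastFiring-injective (v ∷ vs) {u} {x} 0<t′u t′u≡t′x =
  by-cases (m≤n⇒m<n∨m≡n (z≤n {lastFiring vs u})) (m≤n⇒m<n∨m≡n (z≤n {lastFiring vs x}))
  where
  fired-vs-unfired : ∀ {y z} → 0 < lastFiring vs y → 0 ≡ lastFiring vs z →
                     lastFiring (v ∷ vs) y ≢ lastFiring (v ∷ vs) z
  fired-vs-unfired 0<ty 0≡tz t′y≡t′z =
    <⇒≱ (subst (1 <_) (trans (sym (lastFiring-∷-fired v vs 0<ty)) t′y≡t′z) (s≤s 0<ty)) (lastFiring-∷-≤1 v vs (sym 0≡tz))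
  by-cases : 0 < lastFiring vs u ⊎ 0 ≡ lastFiring vs u → 0 < lastFiring vs x ⊎ 0 ≡ lastFiring vs x → u ≡ x
  by-cases (inj₁ 0<tu) (inj₁ 0<tx) = lastFiring-injective vs 0<tu
    (suc-injective (trans (sym (lastFiring-∷-fired v vs 0<tu)) (trans t′u≡t′x (lastFiring-∷-fired v vs 0<tx))))
  by-cases (inj₁ 0<tu) (inj₂ 0≡tx) = contradiction t′u≡t′x (fired-vs-unfired 0<tu 0≡tx)
  by-cases (inj₂ 0≡tu) (inj₁ 0<tx) = contradiction (sym t′u≡t′x) (fired-vs-unfired 0<tx 0≡tu)
  by-cases (inj₂ 0≡tu) (inj₂ 0≡tx) =
    trans (unfired⇒≡v 0≡tu 0<t′u) (sym (unfired⇒≡v 0≡tx (subst (0 <_) t′u≡t′x 0<t′u)))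
    where
    unfired⇒≡v : ∀ {y} → 0 ≡ lastFiring vs y → 0 < lastFiring (v ∷ vs) y → y ≡ v
    unfired⇒≡v {y} 0≡ty 0<t′y =
      indicator-pos (y ≟ v) (subst (0 <_) (lastFiring-∷-unfired v vs (sym 0≡ty)) 0<t′y)

module _ {n} (G : Graph n) where

  firedIn : List (Fin n) → Fin n → ℕ
  firedIn vs u = count (adjacent? G u ∩? λ x → 0 <? lastFiring vs x)

  unfired-gains : ∀ {c vs d u} → LegalSeq G c vs d → lastFiring vs u ≡ 0 → c u + firedIn vs u ≤ d u
  unfired-gains {c} {[]} {d} {u} (done c≗d) _ = ≤-reflexive (begin
    c u + firedIn [] u  ≡⟨ cong (c u +_) (count-none λ _ ()) ⟩
    c u + 0             ≡⟨ +-identityʳ (c u) ⟩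
    c u                 ≡⟨ c≗d u ⟩
    d u                 ∎)
    where open ≡-Reasoning
  unfired-gains {c} {v ∷ vs} {d} {u} (fire∷ _ seq) t′u≡0 = begin
    c u + firedIn (v ∷ vs) u                             ≤⟨ +-monoʳ-≤ (c u) v-fired-last ⟩
    c u + (firedIn vs u + indicator (adjacent? G v u))   ≡⟨ cong (c u +_) (+-comm (firedIn vs u) _) ⟩
    c u + (indicator (adjacent? G v u) + firedIn vs u)   ≡⟨ +-assoc (c u) _ _ ⟨
    c u + indicator (adjacent? G v u) + firedIn vs u     ≡⟨ cong (_+ firedIn vs u) (fire-other G c v u≢v) ⟨
    fire G c v u + firedIn vs u                          ≤⟨ unfired-gains seq tu≡0 ⟩
    d u                                                  ∎
    where
    open ≤-Reasoning
    tu≡0 = proj₁ (lastFiring-∷-unfired⁻ v vs t′u≡0)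
    u≢v  = proj₂ (lastFiring-∷-unfired⁻ v vs t′u≡0)
    after? = adjacent? G u ∩? λ x → 0 <? lastFiring (v ∷ vs) x
    before? = adjacent? G u ∩? λ x → 0 <? lastFiring vs x
    v-fired-last : firedIn (v ∷ vs) u ≤ firedIn vs u + indicator (adjacent? G v u)
    v-fired-last = begin
      count after?                                ≤⟨ m≤m+n _ _ ⟩
      count after? + indicator (before? v)        ≤⟨ count-≤-except v (λ x≢v → map₂ (lastFiring-∷-fired⁻ v vs x≢v)) ⟩
      count before? + indicator (after? v)        ≤⟨ +-monoʳ-≤ (count before?)
                                                       (indicator-mono (after? v) (adjacent? G v u) (Adjacent-sym G ∘ proj₁)) ⟩
      count before? + indicator (adjacent? G v u) ∎

  outdeg-lastFiring≤ : ∀ {c vs d} → LegalSeq G c vs d → ∀ u → outdeg G (lastFiring vs) u ≤ d u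
  outdeg-lastFiring≤ {vs = []} _ u = ≤-trans (≤-reflexive (count-none λ _ ())) z≤n
  outdeg-lastFiring≤ {c} {v ∷ vs} {d} (fire∷ legal seq) u =
    by-cases (m≤n⇒m<n∨m≡n (z≤n {lastFiring vs u})) (u ≟ v)
    where
    t′ = lastFiring (v ∷ vs)
    by-cases : 0 < lastFiring vs u ⊎ 0 ≡ lastFiring vs u → Dec (u ≡ v) → outdeg G t′ u ≤ d u
    by-cases (inj₁ 0<tu) _ = begin
      outdeg G t′ u                ≡⟨ count-cong (map₂ (Equivalence.to (lastFiring-∷-<-fired v vs 0<tu)))
                                                 (map₂ (Equivalence.from (lastFiring-∷-<-fired v vs 0<tu))) ⟩
      outdeg G (lastFiring vs) u   ≤⟨ outdeg-lastFiring≤ seq u ⟩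
      d u                          ∎
      where open ≤-Reasoning
    by-cases (inj₂ 0≡tu) (no u≢v) = begin
      outdeg G t′ u             ≤⟨ count-mono (map₂ above-u-fired) ⟩
      firedIn (v ∷ vs) u        ≤⟨ m≤n+m _ (c u) ⟩
      c u + firedIn (v ∷ vs) u  ≤⟨ unfired-gains (fire∷ legal seq) t′u≡0 ⟩
      d u                       ∎
      where
      open ≤-Reasoning
      t′u≡0 : t′ u ≡ 0
      t′u≡0 = trans (lastFiring-∷-unfired v vs (sym 0≡tu)) (indicator-no (u ≟ v) u≢v)
      above-u-fired : ∀ {x} → t′ u < t′ x → 0 < t′ x
      above-u-fired {x} = subst (_< t′ x) t′u≡0
    by-cases (inj₂ 0≡tu) (yes refl) = begin
      outdeg G t′ u                ≤⟨ count-mono (map₂ above-u-fired-before) ⟩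
      firedIn vs u                 ≤⟨ m≤n+m _ (fire G c u u) ⟩
      fire G c u u + firedIn vs u  ≤⟨ unfired-gains seq (sym 0≡tu) ⟩
      d u                          ∎
      where
      open ≤-Reasoning
      t′u≡1 : t′ u ≡ 1
      t′u≡1 = trans (lastFiring-∷-unfired v vs (sym 0≡tu)) (indicator-yes (u ≟ u) refl)
      above-u-fired-before : ∀ {x} → t′ u < t′ x → 0 < lastFiring vs x
      above-u-fired-before {x} = lastFiring-∷-1< v vs ∘ subst (_< t′ x) t′u≡1

  unfired-closed : ∀ {c vs u x} → LegalSeq G c vs c → lastFiring vs u ≡ 0 → Adjacent G u x → lastFiring vs x ≡ 0
  unfired-closed {c} {vs} {u} {x} seq tu≡0 u~x = n≤0⇒n≡0 (≮⇒≥ λ 0<tx →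
    <⇒≱ (count-pos {P? = adjacent? G u ∩? λ y → 0 <? lastFiring vs y} (u~x , 0<tx))
        (+-cancelˡ-≤ (c u) _ 0 (≤-trans (unfired-gains seq tu≡0) (≤-reflexive (sym (+-identityʳ (c u)))))))

  unfired-walk : ∀ {c vs u w} → LegalSeq G c vs c → Walk G u w → lastFiring vs u ≡ 0 → lastFiring vs w ≡ 0
  unfired-walk seq (here _)      tu≡0 = tu≡0
  unfired-walk seq (step e walk) tu≡0 = unfired-walk seq walk (unfired-closed seq tu≡0 (subst T (sym e) tt))

SelfReachable⇒AcyclicOrientationBelow : ∀ {n} {G : Graph n} {c} → Connected G →
                                         SelfReachable G c → AcyclicOrientationBelow G c
SelfReachable⇒AcyclicOrientationBelow conn ([] , []≢[] , _) = contradiction refl []≢[]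
SelfReachable⇒AcyclicOrientationBelow {G = G} conn (v ∷ vs , _ , seq) = record
  { rank           = lastFiring (v ∷ vs)
  ; rank-injective = λ {u} → lastFiring-injective (v ∷ vs) (fired u)
  ; outdeg≤        = outdeg-lastFiring≤ G seq
  }
  where
  fired : ∀ u → 0 < lastFiring (v ∷ vs) u
  fired u = n≢0⇒n>0 λ tu≡0 → <⇒≢ (lastFiring-∷-head v vs) (sym (unfired-walk G seq (conn u v) tu≡0))

-- Moving a vertex to just below another one in a ranking

2+2a<2+2b⇔a<b : ∀ {a b} → 2 + 2 * a < 2 + 2 * b ⇔ a < b
2+2a<2+2b⇔a<b {a} {b} = mk⇔ (*-cancelˡ-< 2 a b ∘ ≤-pred ∘ ≤-pred) (s≤s ∘ s≤s ∘ *-monoʳ-< 2)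

1+2a<2+2b⇔a≤b : ∀ {a b} → suc (2 * a) < 2 + 2 * b ⇔ a ≤ b
1+2a<2+2b⇔a≤b {a} {b} = mk⇔ (*-cancelˡ-≤ 2 ∘ ≤-pred ∘ ≤-pred) (s≤s ∘ s≤s ∘ *-monoʳ-≤ 2)

2+2a<1+2b⇔a<b : ∀ {a b} → 2 + 2 * a < suc (2 * b) ⇔ a < b
2+2a<1+2b⇔a<b {a} {b} = mk⇔
  (λ lt → *-cancelˡ-≤ 2 (subst (_≤ 2 * b) (sym (*-suc 2 a)) (≤-pred lt)))
  (λ lt → s≤s (subst (_≤ 2 * b) (*-suc 2 a) (*-monoʳ-≤ 2 lt)))

-- the old ranks are doubled to make room for the moved vertex
moveBelow : ∀ {n} → (Fin n → ℕ) → Fin n → Fin n → Fin n → ℕ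
moveBelow r i u y = if does (y ≟ i) then suc (2 * r u) else 2 + 2 * r y

module _ {n} (r : Fin n → ℕ) (i u : Fin n) where

  moveBelow-self : moveBelow r i u i ≡ suc (2 * r u)
  moveBelow-self rewrite dec-true (i ≟ i) refl = refl

  moveBelow-other : ∀ {y} → y ≢ i → moveBelow r i u y ≡ 2 + 2 * r y
  moveBelow-other {y} y≢i rewrite dec-false (y ≟ i) y≢i = refl

  moveBelow-<-other : ∀ {y x} → y ≢ i → x ≢ i → moveBelow r i u y < moveBelow r i u x ⇔ r y < r x
  moveBelow-<-other y≢i x≢i rewrite moveBelow-other y≢i | moveBelow-other x≢i = 2+2a<2+2b⇔a<b

  moveBelow-self-< : ∀ {x} → x ≢ i → moveBelow r i u i < moveBelow r i u x ⇔ r u ≤ r x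
  moveBelow-self-< x≢i rewrite moveBelow-self | moveBelow-other x≢i = 1+2a<2+2b⇔a≤b

  moveBelow-<-self : ∀ {y} → y ≢ i → moveBelow r i u y < moveBelow r i u i ⇔ r y < r u
  moveBelow-<-self y≢i rewrite moveBelow-self | moveBelow-other y≢i = 2+2a<1+2b⇔a<b

  moveBelow-self-≢ : ∀ {x} → x ≢ i → moveBelow r i u i ≢ moveBelow r i u x
  moveBelow-self-≢ {x} x≢i eq with r u ≤? r x
  ... | yes u≤x = <-irrefl eq (Equivalence.from (moveBelow-self-< x≢i) u≤x)
  ... | no  u≰x = <-irrefl (sym eq) (Equivalence.from (moveBelow-<-self x≢i) (≰⇒> u≰x))

  moveBelow-injective : Injective _≡_ _≡_ r → Injective _≡_ _≡_ (moveBelow r i u)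
  moveBelow-injective r-inj {y} {x} eq = by-cases (y ≟ i) (x ≟ i)
    where
    by-cases : Dec (y ≡ i) → Dec (x ≡ i) → y ≡ x
    by-cases (yes y≡i) (yes x≡i) = trans y≡i (sym x≡i)
    by-cases (yes refl) (no x≢i) = contradiction eq (moveBelow-self-≢ x≢i)
    by-cases (no y≢i) (yes refl) = contradiction (sym eq) (moveBelow-self-≢ y≢i)
    by-cases (no y≢i) (no x≢i) = r-inj (*-cancelˡ-≡ _ _ 2 (suc-injective (suc-injective
      (trans (sym (moveBelow-other y≢i)) (trans eq (moveBelow-other x≢i))))))

module _ {n} (G : Graph n) {r : Fin n → ℕ} {i u : Fin n} (u<i : r u < r i) where

  outdeg-moveBelow-other : ∀ {y} → y ≢ i → outdeg G (moveBelow r i u) y ≤ outdeg G r y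
  outdeg-moveBelow-other {y} y≢i = count-mono (map₂ still-above)
    where
    still-above : ∀ {x} → moveBelow r i u y < moveBelow r i u x → r y < r x
    still-above {x} y<x = by-cases (x ≟ i)
      where
      by-cases : Dec (x ≡ i) → r y < r x
      by-cases (yes refl) = <-trans (Equivalence.to (moveBelow-<-self r i u y≢i) y<x) u<i
      by-cases (no x≢i)   = Equivalence.to (moveBelow-<-other r i u y≢i x≢i) y<x

  module _ (i~u : Adjacent G i u) where

    outdeg-moveBelow-lower : suc (outdeg G (moveBelow r i u) u) ≡ outdeg G r u
    outdeg-moveBelow-lower = begin
      suc (count after?)                  ≡⟨ +-comm 1 (count after?) ⟩
      count after? + 1                    ≡⟨ cong (count after? +_) (indicator-yes (before? i) (Adjacent-sym G i~u , u<i)) ⟨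
      count after? + indicator (before? i) ≡⟨ count-≡-except i (λ x≢i → map₂ (Equivalence.to (same-order x≢i)))
                                                               (λ x≢i → map₂ (Equivalence.from (same-order x≢i))) ⟩
      count before? + indicator (after? i) ≡⟨ cong (count before? +_) (indicator-no (after? i) λ (_ , u<′i) →
                                                <-irrefl refl (Equivalence.to (moveBelow-<-self r i u u≢i) u<′i)) ⟩
      count before? + 0                   ≡⟨ +-identityʳ _ ⟩
      count before?                       ∎
      where
      open ≡-Reasoning
      u≢i = Adjacent⇒≢ G i~u ∘ sym
      same-order : ∀ {x} → x ≢ i → moveBelow r i u u < moveBelow r i u x ⇔ r u < r x
      same-order = moveBelow-<-other r i u u≢i
      after? = adjacent? G u ∩? λ x → moveBelow r i u u <? moveBelow r i u x
      before? = adjacent? G u ∩? λ x → r u <? r x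

    outdeg-moveBelow-self : Injective _≡_ _≡_ r → (∀ {x} → Adjacent G i x → r x < r i → r x ≤ r u) →
                            outdeg G (moveBelow r i u) i ≤ suc (outdeg G r i)
    outdeg-moveBelow-self r-inj u-greatest = begin
      count after?                         ≤⟨ m≤m+n _ _ ⟩
      count after? + indicator (before? u) ≤⟨ count-≤-except u (λ x≢u (i~x , i<′x) → i~x , above-i x≢u i~x i<′x) ⟩
      count before? + indicator (after? u) ≤⟨ +-monoʳ-≤ (count before?) (indicator-mono (after? u) (yes tt) _) ⟩
      count before? + 1                    ≡⟨ +-comm (count before?) 1 ⟩
      suc (count before?)                  ∎
      where
      open ≤-Reasoning
      after? = adjacent? G i ∩? λ x → moveBelow r i u i <? moveBelow r i u x
      before? = adjacent? G i ∩? λ x → r i <? r x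
      above-i : ∀ {x} → x ≢ u → Adjacent G i x → moveBelow r i u i < moveBelow r i u x → r i < r x
      above-i {x} x≢u i~x i<′x = ≤∧≢⇒< (≮⇒≥ λ x<i → <⇒≱ u<x (u-greatest i~x x<i)) (Adjacent⇒≢ G i~x ∘ r-inj)
        where
        u<x : r u < r x
        u<x = ≤∧≢⇒< (Equivalence.to (moveBelow-self-< r i u (Adjacent⇒≢ G i~x ∘ sym)) i<′x) (x≢u ∘ sym ∘ r-inj)

∑∑-symmetrise : ∀ {n} (f : Fin n → Fin n → ℕ) →
  ∑[ u < n ] ∑[ x < n ] f u x + ∑[ u < n ] ∑[ x < n ] f u x ≡ ∑[ u < n ] ∑[ x < n ] (f u x + f x u)
∑∑-symmetrise {n} f = begin
  S + S                                              ≡⟨ cong (S +_) (∑-comm f) ⟩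
  S + ∑[ u < n ] ∑[ x < n ] f x u                    ≡⟨ ∑-distrib-+ (λ u → ∑[ x < n ] f u x) (λ u → ∑[ x < n ] f x u) ⟨
  ∑[ u < n ] (∑[ x < n ] f u x + ∑[ x < n ] f x u)   ≡⟨ sum-cong-≗ (λ u → ∑-distrib-+ (f u) (λ x → f x u)) ⟨
  ∑[ u < n ] ∑[ x < n ] (f u x + f x u)              ∎
  where
  open ≡-Reasoning
  S = ∑[ u < n ] ∑[ x < n ] f u x

weight : ∀ {n} → (Fin n → ℕ) → Config n → ℕ
weight {n} w c = ∑[ u < n ] (w u * c u)

module _ {n} (G : Graph n) (w : Fin n → ℕ) where

  pairCost : (Fin n → ℕ) → Fin n → Fin n → ℕ
  pairCost r u x = w u * indicator (adjacent? G u x ×-dec r u <? r x) + w x * indicator (adjacent? G x u ×-dec r x <? r u)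

  pairCost-lower : ∀ {r u x} → Adjacent G u x → r u < r x → pairCost r u x ≡ w u
  pairCost-lower {r} {u} {x} u~x u<x = begin
    pairCost r u x     ≡⟨ cong₂ (λ a b → w u * a + w x * b)
                            (indicator-yes (adjacent? G u x ×-dec r u <? r x) (u~x , u<x))
                            (indicator-no (adjacent? G x u ×-dec r x <? r u) (<-asym u<x ∘ proj₂)) ⟩
    w u * 1 + w x * 0  ≡⟨ cong₂ _+_ (*-identityʳ (w u)) (*-zeroʳ (w x)) ⟩
    w u + 0            ≡⟨ +-identityʳ (w u) ⟩
    w u                ∎
    where open ≡-Reasoning

  pairCost-edge : ∀ {r u x} → Injective _≡_ _≡_ r → Adjacent G u x →
                  r u < r x × pairCost r u x ≡ w u ⊎ r x < r u × pairCost r u x ≡ w x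
  pairCost-edge {r} {u} {x} r-inj u~x with ≢⇒<⊎> (Adjacent⇒≢ G u~x ∘ r-inj)
  ... | inj₁ u<x = inj₁ (u<x , pairCost-lower u~x u<x)
  ... | inj₂ x<u = inj₂ (x<u , trans (+-comm (w u * _) (w x * _)) (pairCost-lower (Adjacent-sym G u~x) x<u))

  pairCost-non-edge : ∀ {r u x} → ¬ Adjacent G u x → pairCost r u x ≡ 0
  pairCost-non-edge {r} {u} {x} ¬u~x = trans
    (cong₂ (λ a b → w u * a + w x * b)
      (indicator-no (adjacent? G u x ×-dec r u <? r x) (¬u~x ∘ proj₁))
      (indicator-no (adjacent? G x u ×-dec r x <? r u) (¬u~x ∘ Adjacent-sym G ∘ proj₁)))
    (cong₂ _+_ (*-zeroʳ (w u)) (*-zeroʳ (w x)))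

  WeightIncreasing : (Fin n → ℕ) → Set
  WeightIncreasing r = ∀ {u x} → Adjacent G u x → r u < r x → w u < w x

  weight-outdeg-double : ∀ r → 2 * weight w (outdeg G r) ≡ ∑[ u < n ] ∑[ x < n ] pairCost r u x
  weight-outdeg-double r = begin
    2 * weight w (outdeg G r)  ≡⟨ cong (2 *_) (sum-cong-≗ λ u → *-count (w u)) ⟩
    2 * S                      ≡⟨ cong (S +_) (+-identityʳ S) ⟩
    S + S                      ≡⟨ ∑∑-symmetrise (λ u x → w u * indicator (out? u x)) ⟩
    ∑[ u < n ] ∑[ x < n ] pairCost r u x ∎
    where
    open ≡-Reasoning
    out? = λ u x → adjacent? G u x ×-dec r u <? r x
    S = ∑[ u < n ] ∑[ x < n ] (w u * indicator (out? u x))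

  module _ {r s : Fin n → ℕ} (r-inj : Injective _≡_ _≡_ r) (r-up : WeightIncreasing r)
           (s-inj : Injective _≡_ _≡_ s) where

    pairCost-minimal : ∀ u x → pairCost r u x ≤ pairCost s u x
    pairCost-minimal u x with toSum (adjacent? G u x)
    ... | inj₂ ¬u~x = ≤-reflexive (trans (pairCost-non-edge {r} ¬u~x) (sym (pairCost-non-edge {s} ¬u~x)))
    ... | inj₁ u~x with pairCost-edge r-inj u~x | pairCost-edge s-inj u~x
    ...   | inj₁ (_ , r≡)   | inj₁ (_ , s≡) = ≤-reflexive (trans r≡ (sym s≡))
    ...   | inj₁ (u<x , r≡) | inj₂ (_ , s≡) = subst₂ _≤_ (sym r≡) (sym s≡) (<⇒≤ (r-up u~x u<x))
    ...   | inj₂ (x<u , r≡) | inj₁ (_ , s≡) = subst₂ _≤_ (sym r≡) (sym s≡) (<⇒≤ (r-up (Adjacent-sym G u~x) x<u))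
    ...   | inj₂ (_ , r≡)   | inj₂ (_ , s≡) = ≤-reflexive (trans r≡ (sym s≡))

    weight-outdeg-minimal : weight w (outdeg G r) ≤ weight w (outdeg G s)
    weight-outdeg-minimal = *-cancelˡ-≤ 2 (subst₂ _≤_ (sym (weight-outdeg-double r)) (sym (weight-outdeg-double s))
      (∑-mono-≤ λ u → ∑-mono-≤ (pairCost-minimal u)))

    weight-outdeg-rigid : weight w (outdeg G s) ≤ weight w (outdeg G r) → ∀ u → outdeg G s u ≡ outdeg G r u
    weight-outdeg-rigid s≤r u =
      count-cong (λ (u~x , su<sx) → u~x , s⇒r u~x su<sx) (λ (u~x , ru<rx) → u~x , r⇒s u~x ru<rx)
      where
      rows : ∀ u → ∑[ x < n ] pairCost r u x ≡ ∑[ x < n ] pairCost s u x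
      rows = ∑-≤-antisym (λ u → ∑-mono-≤ (pairCost-minimal u))
        (subst₂ _≤_ (weight-outdeg-double s) (weight-outdeg-double r) (*-monoʳ-≤ 2 s≤r))
      pairs : ∀ u x → pairCost r u x ≡ pairCost s u x
      pairs u = ∑-≤-antisym (pairCost-minimal u) (≤-reflexive (sym (rows u)))
      r⇒s : ∀ {u x} → Adjacent G u x → r u < r x → s u < s x
      r⇒s {u} {x} u~x u<x with pairCost-edge s-inj u~x
      ... | inj₁ (su<sx , _) = su<sx
      ... | inj₂ (_ , s≡)    =
        contradiction (trans (sym s≡) (trans (sym (pairs u x)) (pairCost-lower u~x u<x))) (≢-sym (<⇒≢ (r-up u~x u<x)))
      s⇒r : ∀ {u x} → Adjacent G u x → s u < s x → r u < r x
      s⇒r {u} {x} u~x su<sx with ≢⇒<⊎> (Adjacent⇒≢ G u~x ∘ r-inj)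
      ... | inj₁ ru<rx = ru<rx
      ... | inj₂ rx<ru = contradiction (r⇒s (Adjacent-sym G u~x) rx<ru) (<-asym su<sx)

-- Separation from a convex hull by a linear functional

module ℚΣ = SemiringSum (CommutativeRing.semiring ℚ.+-*-commutativeRing)
open CommutativeSemigroupProperties (CommutativeRing.*-commutativeSemigroup ℚ.+-*-commutativeRing)
  using () renaming (x∙yz≈y∙xz to ℚ*-left-comm)

toℚ-mkℚ : ∀ k → toℚ k ≡ mkℚ (ℤ.+ k) 0 (Coprime.sym (1-coprimeTo k))
toℚ-mkℚ k = ℚ.normalize-coprime (Coprime.sym (1-coprimeTo k))

toℚ-+ : ∀ a b → toℚ (a + b) ≡ toℚ a ℚ.+ toℚ b
toℚ-+ a b rewrite toℚ-mkℚ a | toℚ-mkℚ b =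
  cong (ℚ._/ 1) (trans (ℤ.pos-+ a b) (sym (cong₂ ℤ._+_ (ℤ.*-identityʳ (ℤ.+ a)) (ℤ.*-identityʳ (ℤ.+ b)))))

toℚ-* : ∀ a b → toℚ (a * b) ≡ toℚ a ℚ.* toℚ b
toℚ-* a b rewrite toℚ-mkℚ a | toℚ-mkℚ b = cong (ℚ._/ 1) (ℤ.pos-* a b)

toℚ-mono-≤ : ∀ {a b} → a ≤ b → toℚ a ℚ.≤ toℚ b
toℚ-mono-≤ {a} {b} a≤b rewrite toℚ-mkℚ a | toℚ-mkℚ b =
  ℚ.*≤* (subst₂ ℤ._≤_ (sym (ℤ.*-identityʳ (ℤ.+ a))) (sym (ℤ.*-identityʳ (ℤ.+ b))) (ℤ.+≤+ a≤b))

toℚ-cancel-≤ : ∀ {a b} → toℚ a ℚ.≤ toℚ b → a ≤ b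
toℚ-cancel-≤ {a} {b} a≤b rewrite toℚ-mkℚ a | toℚ-mkℚ b with a≤b
... | ℚ.*≤* a≤b = ℤ.drop‿+≤+ (subst₂ ℤ._≤_ (ℤ.*-identityʳ (ℤ.+ a)) (ℤ.*-identityʳ (ℤ.+ b)) a≤b)

toℚ-sum : ∀ {n} (f : Fin n → ℕ) → toℚ (sum f) ≡ ℚΣ.sum (toℚ ∘ f)
toℚ-sum {zero}  f = refl
toℚ-sum {suc n} f = trans (toℚ-+ (f zero) _) (cong (toℚ (f zero) ℚ.+_) (toℚ-sum (f ∘ suc)))

module _ {A : Set} where

  sumℚ-*ˡ : ∀ (xs : List A) a (f : A → ℚ) → sumℚ (map (λ p → a ℚ.* f p) xs) ≡ a ℚ.* sumℚ (map f xs)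
  sumℚ-*ˡ []       a f = sym (ℚ.*-zeroʳ a)
  sumℚ-*ˡ (x ∷ xs) a f = trans (cong (a ℚ.* f x ℚ.+_) (sumℚ-*ˡ xs a f)) (sym (ℚ.*-distribˡ-+ a (f x) _))

  sumℚ-∑-comm : ∀ {n} (xs : List A) (h : A → Fin n → ℚ) →
                sumℚ (map (λ p → ℚΣ.sum (h p)) xs) ≡ ℚΣ.sum (λ u → sumℚ (map (λ p → h p u) xs))
  sumℚ-∑-comm {n} []       h = sym (ℚΣ.sum-replicate-zero n)
  sumℚ-∑-comm     (x ∷ xs) h = trans (cong (ℚΣ.sum (h x) ℚ.+_) (sumℚ-∑-comm xs h)) (sym (ℚΣ.∑-distrib-+ (h x) _))

module _ {n} (w : Fin n → ℕ) where

  averageWeight : List (ℚ × Config n) → ℚ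
  averageWeight pts = sumℚ (map (λ p → proj₁ p ℚ.* toℚ (weight w (proj₂ p))) pts)

  module _ {P : Config n → Set} {ν : Config n} where

    ConvComb-averageWeight : (cc : ConvComb P ν) → averageWeight (ConvComb.pts cc) ≡ toℚ (weight w ν)
    ConvComb-averageWeight cc = begin
      averageWeight pts                                ≡⟨ cong sumℚ (map-cong expand pts) ⟩
      sumℚ (map (λ p → ℚΣ.sum (term p)) pts)           ≡⟨ sumℚ-∑-comm pts term ⟩
      ℚΣ.sum (λ u → sumℚ (map (λ p → term p u) pts))   ≡⟨ ℚΣ.sum-cong-≗ coordinate ⟩
      ℚΣ.sum (λ u → toℚ (w u) ℚ.* toℚ (ν u))           ≡⟨ ℚΣ.sum-cong-≗ (λ u → toℚ-* (w u) (ν u)) ⟨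
      ℚΣ.sum (λ u → toℚ (w u * ν u))                   ≡⟨ toℚ-sum (λ u → w u * ν u) ⟨
      toℚ (weight w ν)                                 ∎
      where
      open ConvComb cc
      open ≡-Reasoning
      term : ℚ × Config n → Fin n → ℚ
      term (a , c) u = toℚ (w u) ℚ.* (a ℚ.* toℚ (c u))
      expand : ∀ p → proj₁ p ℚ.* toℚ (weight w (proj₂ p)) ≡ ℚΣ.sum (term p)
      expand (a , c) = begin
        a ℚ.* toℚ (weight w c)                          ≡⟨ cong (a ℚ.*_) (toℚ-sum (λ u → w u * c u)) ⟩
        a ℚ.* ℚΣ.sum (λ u → toℚ (w u * c u))            ≡⟨ ℚΣ.*-distribˡ-sum a (λ u → toℚ (w u * c u)) ⟩
        ℚΣ.sum (λ u → a ℚ.* toℚ (w u * c u))            ≡⟨ ℚΣ.sum-cong-≗ (λ u → cong (a ℚ.*_) (toℚ-* (w u) (c u))) ⟩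
        ℚΣ.sum (λ u → a ℚ.* (toℚ (w u) ℚ.* toℚ (c u)))  ≡⟨ ℚΣ.sum-cong-≗ (λ u → ℚ*-left-comm a (toℚ (w u)) (toℚ (c u))) ⟩
        ℚΣ.sum (term (a , c))                           ∎
      coordinate : ∀ u → sumℚ (map (λ p → term p u) pts) ≡ toℚ (w u) ℚ.* toℚ (ν u)
      coordinate u = trans (sumℚ-*ˡ pts (toℚ (w u)) (λ p → proj₁ p ℚ.* toℚ (proj₂ p u)))
                           (cong (toℚ (w u) ℚ.*_) (combo u))

    ¬ConvComb-below : (∀ c → P c → weight w ν < weight w c) → ¬ ConvComb P ν
    ¬ConvComb-below ν<P cc = <-irrefl refl (toℚ-cancel-≤ {suc (weight w ν)} {weight w ν} (begin
      K                              ≡⟨ ℚ.*-identityˡ K ⟨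
      1ℚ ℚ.* K                       ≡⟨ cong (ℚ._* K) total ⟨
      sumℚ (map proj₁ pts) ℚ.* K     ≤⟨ bound pts nonneg inP ⟩
      averageWeight pts              ≡⟨ ConvComb-averageWeight cc ⟩
      toℚ (weight w ν)               ∎))
      where
      open ConvComb cc
      open ℚ.≤-Reasoning
      K = toℚ (suc (weight w ν))
      bound : ∀ xs → All (λ p → 0ℚ ℚ.≤ proj₁ p) xs → All (P ∘ proj₂) xs →
              sumℚ (map proj₁ xs) ℚ.* K ℚ.≤ averageWeight xs
      bound []             []                []          = ℚ.≤-reflexive (ℚ.*-zeroˡ K)
      bound ((a , c) ∷ xs) (0≤a ∷ nonneg-xs) (pc ∷ P-xs) = begin
        (a ℚ.+ sumℚ (map proj₁ xs)) ℚ.* K        ≡⟨ ℚ.*-distribʳ-+ K a (sumℚ (map proj₁ xs)) ⟩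
        a ℚ.* K ℚ.+ sumℚ (map proj₁ xs) ℚ.* K    ≤⟨ ℚ.+-mono-≤ (ℚ.*-monoˡ-≤-nonNeg a {{ℚ.nonNegative 0≤a}} (toℚ-mono-≤ (ν<P c pc)))
                                                               (bound xs nonneg-xs P-xs) ⟩
        averageWeight ((a , c) ∷ xs)             ∎

module _ {n} (c : Config n) (u : Fin n) where

  minusE-self : minusE c u u ≡ c u ∸ 1
  minusE-self rewrite dec-true (u ≟ u) refl = refl

  minusE-other : ∀ {x} → x ≢ u → minusE c u x ≡ c x
  minusE-other {x} x≢u rewrite dec-false (x ≟ u) x≢u = refl

  minusE-≤ : ∀ {f : Fin n → ℕ} → (∀ x → f x ≤ c x) → f u < c u → ∀ x → f x ≤ minusE c u x
  minusE-≤ {f} f≤c fu<cu x = by-cases (x ≟ u)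
    where
    by-cases : Dec (x ≡ u) → f x ≤ minusE c u x
    by-cases (yes refl) = subst (f x ≤_) (sym minusE-self) (<⇒≤∸1 fu<cu)
    by-cases (no x≢u)   = subst (f x ≤_) (sym (minusE-other x≢u)) (f≤c x)

module NearMinimal {n} {G : Graph n} (conn : Connected G) (1≤n : 1 ≤ n) {ν : Config n} {i : Fin n}
                   (ν-sr : SelfReachable G ν) (i-removable : MinusSR G ν i)
                   (only-i : ∀ j → MinusSR G ν j → j ≡ i) where

  open AcyclicOrientationBelow (SelfReachable⇒AcyclicOrientationBelow conn ν-sr)
    renaming (rank to r; rank-injective to r-inj; outdeg≤ to outdeg≤ν)

  removable⇒≡i : ∀ {u s} → Injective _≡_ _≡_ s → (∀ x → outdeg G s x ≤ minusE ν u x) → 0 < ν u → u ≡ i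
  removable⇒≡i {u} {s} s-inj s≤ν-u 0<νu = only-i u (0<νu , AcyclicOrientationBelow⇒SelfReachable 1≤n
    record { rank = s ; rank-injective = s-inj ; outdeg≤ = s≤ν-u })

  tight : ∀ {u} → u ≢ i → ν u ≡ outdeg G r u
  tight {u} u≢i with m≤n⇒m<n∨m≡n (outdeg≤ν u)
  ... | inj₂ outdeg≡ν = sym outdeg≡ν
  ... | inj₁ outdeg<ν = contradiction (removable⇒≡i r-inj (minusE-≤ ν u outdeg≤ν outdeg<ν) (≤-<-trans z≤n outdeg<ν)) u≢i

  excess : outdeg G r i < ν i
  excess = ≤∸1⇒< 0<νi (subst (outdeg G r i ≤_) (minusE-self ν i) (+-cancelˡ-≤ (sum ν-i) _ _ (begin
    sum ν-i + outdeg G r i         ≡⟨ ∑-≡-except i (λ x x≢i → trans (sym (tight x≢i)) (sym (minusE-other ν i x≢i))) ⟨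
    sum (outdeg G r) + ν-i i       ≡⟨ cong (_+ ν-i i) (∑outdeg-invariant G r-inj s-inj) ⟩
    sum (outdeg G s) + ν-i i       ≤⟨ +-monoˡ-≤ (ν-i i) (∑-mono-≤ outdeg≤ν-i) ⟩
    sum ν-i + ν-i i                ∎)))
    where
    open ≤-Reasoning
    ν-i = minusE ν i
    0<νi = proj₁ i-removable
    open AcyclicOrientationBelow (SelfReachable⇒AcyclicOrientationBelow conn (proj₂ i-removable))
      renaming (rank to s; rank-injective to s-inj; outdeg≤ to outdeg≤ν-i)

  no-in-neighbour : ¬ (∃[ x ] Adjacent G i x × r x < r i)
  no-in-neighbour some with greatest (λ x → adjacent? G i x ×-dec r x <? r i) r some
  ... | u , (i~u , u<i) , u-greatest =
    Adjacent⇒≢ G i~u (sym (removable⇒≡i (moveBelow-injective r i u r-inj) r′≤ν-u 0<νu))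
    where
    r′ = moveBelow r i u
    u≢i = Adjacent⇒≢ G i~u ∘ sym
    one-less : suc (outdeg G r′ u) ≡ ν u
    one-less = trans (outdeg-moveBelow-lower G u<i i~u) (sym (tight u≢i))
    0<νu : 0 < ν u
    0<νu = subst (0 <_) one-less (s≤s z≤n)
    r′≤ν-u : ∀ y → outdeg G r′ y ≤ minusE ν u y
    r′≤ν-u y = by-cases (y ≟ u) (y ≟ i)
      where
      by-cases : Dec (y ≡ u) → Dec (y ≡ i) → outdeg G r′ y ≤ minusE ν u y
      by-cases (yes refl) _          = subst (outdeg G r′ u ≤_) (sym (minusE-self ν u)) (<⇒≤∸1 (≤-reflexive one-less))
      by-cases (no y≢u)   (yes refl) = subst (outdeg G r′ i ≤_) (sym (minusE-other ν u y≢u))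
        (≤-trans (outdeg-moveBelow-self G u<i i~u r-inj (λ i~x x<i → u-greatest (i~x , x<i))) excess)
      by-cases (no y≢u)   (no y≢i)   = subst (outdeg G r′ y ≤_) (sym (minusE-other ν u y≢u))
        (≤-trans (outdeg-moveBelow-other G u<i y≢i) (outdeg≤ν y))

  source : ∀ {x} → Adjacent G i x → r i < r x
  source i~x = ≤∧≢⇒< (≮⇒≥ λ x<i → no-in-neighbour (_ , i~x , x<i)) (Adjacent⇒≢ G i~x ∘ r-inj)

  -- i is a source of the orientation, so it can be given the smallest weight 0
  w : Fin n → ℕ
  w y = if does (y ≟ i) then 0 else suc (r y)

  w-i : w i ≡ 0
  w-i rewrite dec-true (i ≟ i) refl = refl

  w-other : ∀ {y} → y ≢ i → w y ≡ suc (r y)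
  w-other {y} y≢i rewrite dec-false (y ≟ i) y≢i = refl

  r-weight-increasing : WeightIncreasing G w r
  r-weight-increasing {u} {x} u~x u<x = by-cases (u ≟ i)
    where
    x≢i : x ≢ i
    x≢i refl = <-asym u<x (source (Adjacent-sym G u~x))
    by-cases : Dec (u ≡ i) → w u < w x
    by-cases (yes refl) = subst₂ _<_ (sym w-i) (sym (w-other x≢i)) (s≤s z≤n)
    by-cases (no u≢i)   = subst₂ _<_ (sym (w-other u≢i)) (sym (w-other x≢i)) (s≤s u<x)

  weight-ν : weight w ν ≡ weight w (outdeg G r)
  weight-ν = sum-cong-≗ λ u → by-cases u (u ≟ i)
    where
    by-cases : ∀ u → Dec (u ≡ i) → w u * ν u ≡ w u * outdeg G r u
    by-cases u (yes refl) = trans (cong (_* ν u) w-i) (sym (cong (_* outdeg G r u) w-i))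
    by-cases u (no u≢i)   = cong (w u *_) (tight u≢i)

  weight-strictly-minimal : ∀ c → SelfReachable G c → chips c ≡ chips ν → ¬ (c ≗c ν) → weight w ν < weight w c
  weight-strictly-minimal c c-sr chips≡ c≢ν = ≰⇒> λ c≤ν → c≢ν (c≗ν c≤ν)
    where
    open AcyclicOrientationBelow (SelfReachable⇒AcyclicOrientationBelow conn c-sr)
      renaming (rank to s; rank-injective to s-inj; outdeg≤ to outdeg≤c)
    ν≤s : weight w ν ≤ weight w (outdeg G s)
    ν≤s = subst (_≤ weight w (outdeg G s)) (sym weight-ν) (weight-outdeg-minimal G w r-inj r-weight-increasing s-inj)
    s≤c : weight w (outdeg G s) ≤ weight w c
    s≤c = ∑-mono-≤ λ u → *-monoʳ-≤ (w u) (outdeg≤c u)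
    c≗ν : weight w c ≤ weight w ν → c ≗c ν
    c≗ν c≤ν u = [ (λ { refl → at-i }) , off-i ]′ (toSum (u ≟ i))
      where
      s≡r : ∀ u → outdeg G s u ≡ outdeg G r u
      s≡r = weight-outdeg-rigid G w r-inj r-weight-increasing s-inj (≤-trans s≤c (≤-trans c≤ν (≤-reflexive weight-ν)))
      s≡c : ∀ u → w u * outdeg G s u ≡ w u * c u
      s≡c = ∑-≤-antisym (λ u → *-monoʳ-≤ (w u) (outdeg≤c u)) (≤-trans c≤ν ν≤s)
      off-i : ∀ {u} → u ≢ i → c u ≡ ν u
      off-i {u} u≢i = begin
        c u             ≡⟨ *-cancelˡ-≡ (c u) (outdeg G s u) (suc (r u))
                             (subst (λ k → k * c u ≡ k * outdeg G s u) (w-other u≢i) (sym (s≡c u))) ⟩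
        outdeg G s u    ≡⟨ s≡r u ⟩
        outdeg G r u    ≡⟨ tight u≢i ⟨
        ν u             ∎
        where open ≡-Reasoning
      at-i : c i ≡ ν i
      at-i = sym (+-cancelˡ-≡ (sum ν) (ν i) (c i) (begin
        sum ν + ν i  ≡⟨ cong (_+ ν i) (trans (sym (Σv≡sum c)) (trans chips≡ (Σv≡sum ν))) ⟨
        sum c + ν i  ≡⟨ ∑-≡-except i (λ x x≢i → off-i x≢i) ⟩
        sum ν + c i  ∎))
        where open ≡-Reasoning

lemma5p9 : ∀ {n} (T : Graph n) → IsTree T → 1 ≤ n →
    ∀ (ℓ : ℕ) → n ≤ ℓ → ∀ (ν : Config n) → NearMinSR T ν → chips ν ≡ ℓ →
    IsVertexOfP T ℓ ν
lemma5p9 T (conn , _) 1≤n ℓ _ ν (i , ν-sr , _ , i-removable , only-i) chips≡ℓ =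
  (ν-sr , chips≡ℓ) ,
  ¬ConvComb-below w λ c ((c-sr , chips-c) , c≢ν) → weight-strictly-minimal c c-sr (trans chips-c (sym chips≡ℓ)) c≢ν
  where open NearMinimal conn 1≤n ν-sr i-removable only-i
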